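{- Let $\mathcal{S}\subset\{0,1\}^{\mathbb{N}}$ be the set of infinite binary sequences that are not eventually constant, and let $k:\mathcal{S}\to\mathcal{S}$ be the Knave map defined below. There exist $S_{even},S_{odd}\in\mathcal{S}$ such that $k(S_{odd})=S_{even}$ and $k(S_{even})=S_{odd}$; that is, each is the literal description of the bitwise complement of the other. Moreover, this pair is unique: if $A,B\in\mathcal{S}$ satisfy $k(A)=B$ and $k(B)=A$, then $\{A,B\}=\{S_{even},S_{odd}\}$.
   Context: For a positive integer $m$, let $[m]$ denote the standard binary representation of $m$, a string beginning with $1$ and having no leading zeros. Every $S\in\mathcal{S}$ decomposes uniquely as a concatenation $S=r_1r_2r_3\cdots$ of maximal runs: each $r_i$ is a nonempty finite block of a single repeated bit $b_i$, and consecutive runs use different bits. The Knave map is $$k(S)=[|r_1|]\,\overline{b_1}\,[|r_2|]\,\overline{b_2}\,[|r_3|]\,\overline{b_3}\cdots,$$ where $|r_i|$ is the length of $r_i$ and $\overline{b}$ is the complement of the bit $b$. For example, $k(110)=10\,0\,1\,1$. -}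

module Defs where

open import Data.Bool using (Bool; true; false; not)
open import Data.Nat using (ℕ; zero; suc; _+_; _∸_; _≤_; _<_; _%_; _/_; _≡ᵇ_)
open import Data.List using (List; []; _∷_; _++_; [_]; reverse; length; lookup)
open import Data.Fin using (fromℕ<)
open import Data.Product using (Σ; _×_; ∃; ∃-syntax)
open import Relation.Binary.PropositionalEquality using (_≡_; _≢_)

Seq : Set
Seq = ℕ → Bool

_≗ˢ_ : Seq → Seq → Set
A ≗ˢ B = ∀ n → A n ≡ B n

NotEventuallyConstant : Seq → Set
NotEventuallyConstant S = ∀ n → ∃[ m ] (n ≤ m × S m ≢ S n)

-- Least-significant-bit-first binary digits, with fuel.
bitsLSB : ℕ → ℕ → List Bool
bitsLSB zero    _       = []
bitsLSB (suc f) zero    = []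
bitsLSB (suc f) (suc m) = ((suc m % 2) ≡ᵇ 1) ∷ bitsLSB f (suc m / 2)

-- [m]: standard binary representation (most significant bit first,
-- starting with 1 for m ≥ 1).
bin : ℕ → List Bool
bin m = reverse (bitsLSB m m)

-- p is the sequence of start positions of the maximal runs of S:
-- run i is the block S[p i .. p (suc i) - 1].
Runs : Seq → (ℕ → ℕ) → Set
Runs S p =
  (p 0 ≡ 0) ×
  (∀ i → p i < p (suc i)) ×
  (∀ i j → p i ≤ j → j < p (suc i) → S j ≡ S (p i)) ×
  (∀ i → S (p (suc i)) ≢ S (p i))

-- The i-th output block of the Knave map: [|r_i|] followed by the complement of b_i.
block : Seq → (ℕ → ℕ) → ℕ → List Bool
block S p i = bin (p (suc i) ∸ p i) ++ [ not (S (p i)) ]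

offset : (ℕ → List Bool) → ℕ → ℕ
offset w zero    = 0
offset w (suc i) = offset w i + length (w i)

-- T is the infinite concatenation w 0 ++ w 1 ++ w 2 ++ ...
-- (all blocks are nonempty, so every position of T is covered).
IsConcat : (ℕ → List Bool) → Seq → Set
IsConcat w T = ∀ i t → (h : t < length (w i)) → T (offset w i + t) ≡ lookup (w i) (fromℕ< h)

-- The Knave map as a relation: k(S) = T.
-- (For S ∈ 𝒮 the run decomposition exists and is unique, so this is the graph of k.)
Knave : Seq → Seq → Set
Knave S T = ∃[ p ] (Runs S p × IsConcat (block S p) T)

module Submission where

-- Every k(S) begins with 1, the leading digit of [|r₁|]; so both members of a 2-cycle
-- begin with 1, and a sequence beginning with 1 is determined by its run lengths
-- R : ℕ → ℕ (seqOf R).  The problem thus becomes one about run lengths: the output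
-- word [R₀]0 · [R₁]1[R₂]0 · [R₃]1[R₄]0 ⋯ splits into pieces of the shape 1⋯0, so its
-- run lengths Ψ R are computed piece by piece (ψ on finite prefixes), and k(seqOf R) =
-- seqOf (Ψ R).  A 2-cycle of k is therefore a pair with X = Ψ Y and Y = Ψ X.
--
-- The pair
-- (runsEven, runsOdd) is built by course-of-values recursion.  For uniqueness, a
-- solution of X = Ψ Y, Y = Ψ X is forced value by value: by causality wherever ψ of
-- the first n runs already reaches index n, and at the three remaining positions
-- 0, 2, 4 by a finite search, the values being < 11 because 2·|[v]| ≤ v + 2.  The only
-- second solution, at position 2, is the swap of X and Y.

open import Defs
open import Data.Bool using (Bool; true; false; not)
open import Data.Bool.Properties using (not-¬; ¬-not)
open import Data.Nat using (ℕ; zero; suc; _+_; _*_; _∸_; _≤_; _<_; _/_; z≤n; s≤s)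
open import Data.Nat.Properties
open import Data.Nat.DivMod using (m/n<m; m≥n⇒m/n>0; m/n*n≤m)
open import Data.List using (List; []; _∷_; _++_; [_]; reverse; length; lookup; replicate)
open import Data.List.Properties using (length-++; length-++-≤ʳ; ++-assoc; ++-identityʳ; length-replicate; length-reverse; reverse-++)
open import Data.List.Relation.Unary.All using (All; []; _∷_)
open import Data.List.Relation.Unary.All.Properties using (++⁺)
open import Data.Fin using (fromℕ<)
open import Data.Product using (Σ; _×_; _,_; proj₁; proj₂)
open import Data.Sum using (_⊎_; inj₁; inj₂)
open import Data.Empty using (⊥-elim)
open import Relation.Binary.PropositionalEquality hiding ([_])
open import Relation.Binary.Definitions using (tri<; tri≈; tri>)
open import Relation.Nullary using (Dec; yes; no)
open import Relation.Nullary.Decidable using (_×-dec_; _⊎-dec_; _→-dec_; from-yes)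

at : {A : Set} → A → List A → ℕ → A
at d []       _       = d
at d (x ∷ xs) zero    = x
at d (x ∷ xs) (suc k) = at d xs k

at-++ʳ : {A : Set} (d : A) (xs ys : List A) (k : ℕ) → at d (xs ++ ys) (length xs + k) ≡ at d ys k
at-++ʳ d []       ys k = refl
at-++ʳ d (x ∷ xs) ys k = at-++ʳ d xs ys k

lookup-at : {A : Set} (d : A) (xs : List A) (t : ℕ) (h : t < length xs) → lookup xs (fromℕ< h) ≡ at d xs t
lookup-at d (x ∷ xs) zero    h       = refl
lookup-at d (x ∷ xs) (suc t) (s≤s h) = lookup-at d xs t h

infix 4 _≼_
_≼_ : {A : Set} → List A → List A → Set
_≼_ {A} xs ys = Σ (List A) λ zs → ys ≡ xs ++ zs

≼-++ : {A : Set} (xs ys : List A) → xs ≼ xs ++ ys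
≼-++ xs ys = ys , refl

++-≼ : {A : Set} (ws : List A) {xs ys : List A} → xs ≼ ys → ws ++ xs ≼ ws ++ ys
++-≼ ws {xs} (zs , refl) = zs , sym (++-assoc ws xs zs)

≼-at : {A : Set} (d : A) {xs ys : List A} (k : ℕ) → xs ≼ ys → k < length xs → at d ys k ≡ at d xs k
≼-at d {x ∷ xs} zero    (zs , refl) _       = refl
≼-at d {x ∷ xs} (suc k) (zs , refl) (s≤s h) = ≼-at d {xs = xs} k (zs , refl) h

≼-compare : {A : Set} (d : A) {xs ys : List A} (k : ℕ) → xs ≼ ys ⊎ ys ≼ xs →
            k < length xs → k < length ys → at d xs k ≡ at d ys k
≼-compare d k (inj₁ xs≼ys) hx hy = sym (≼-at d k xs≼ys hx)
≼-compare d k (inj₂ ys≼xs) hx hy = ≼-at d k ys≼xs hy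

≼-comparable : {A : Set} (f : ℕ → List A) → (∀ {j j′} → j ≤ j′ → f j ≼ f j′) →
               ∀ j j′ → f j ≼ f j′ ⊎ f j′ ≼ f j
≼-comparable f mono j j′ with ≤-total j j′
... | inj₁ j≤j′ = inj₁ (mono j≤j′)
... | inj₂ j′≤j = inj₂ (mono j′≤j)

takeS : {A : Set} → ℕ → (ℕ → A) → List A
takeS zero    f = []
takeS (suc n) f = f 0 ∷ takeS n (λ i → f (suc i))

takeS-length : {A : Set} (n : ℕ) (f : ℕ → A) → length (takeS n f) ≡ n
takeS-length zero    f = refl
takeS-length (suc n) f = cong suc (takeS-length n (λ i → f (suc i)))

takeS-+ : {A : Set} (a b : ℕ) (f : ℕ → A) → takeS (a + b) f ≡ takeS a f ++ takeS b (λ i → f (a + i))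
takeS-+ zero    b f = refl
takeS-+ (suc a) b f = cong (f 0 ∷_) (takeS-+ a b (λ i → f (suc i)))

takeS-snoc : {A : Set} (n : ℕ) (f : ℕ → A) → takeS (suc n) f ≡ takeS n f ++ [ f n ]
takeS-snoc zero    f = refl
takeS-snoc (suc n) f = cong (f 0 ∷_) (takeS-snoc n (λ i → f (suc i)))

takeS-cong : {A : Set} (n : ℕ) (f g : ℕ → A) → (∀ i → i < n → f i ≡ g i) → takeS n f ≡ takeS n g
takeS-cong zero    f g h = refl
takeS-cong (suc n) f g h =
  cong₂ _∷_ (h 0 (s≤s z≤n)) (takeS-cong n _ _ (λ i i<n → h (suc i) (s≤s i<n)))

takeS-≼ : {A : Set} {m n : ℕ} (f : ℕ → A) → m ≤ n → takeS m f ≼ takeS n f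
takeS-≼ {m = m} {n} f m≤n =
  _ , trans (cong (λ k → takeS k f) (sym (m+[n∸m]≡n m≤n))) (takeS-+ m (n ∸ m) f)

takeS-≼-list : {A : Set} (d : A) (m : ℕ) (f : ℕ → A) (L : List A) →
               (∀ k → k < m → f k ≡ at d L k) → m ≤ length L → takeS m f ≼ L
takeS-≼-list d zero    f L       h m≤L = L , refl
takeS-≼-list d (suc m) f (x ∷ L) h (s≤s m≤L)
  with takeS-≼-list d m (λ i → f (suc i)) L (λ k k<m → h (suc k) (s≤s k<m)) m≤L
... | zs , L≡ = zs , cong₂ _∷_ (sym (h 0 (s≤s z≤n))) L≡

takeS-positive : (n : ℕ) (f : ℕ → ℕ) → (∀ k → 1 ≤ f k) → All (1 ≤_) (takeS n f)
takeS-positive zero    f pos = []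
takeS-positive (suc n) f pos = pos 0 ∷ takeS-positive n (λ k → f (suc k)) (λ k → pos (suc k))

-- Run-length encoding of finite binary words

-- rl b c ws: the run lengths of the word bᶜ ws (the current run, of bit b, has length c so far).
rl : Bool → ℕ → List Bool → List ℕ
rl b     c []           = c ∷ []
rl true  c (true ∷ ws)  = rl true (suc c) ws
rl true  c (false ∷ ws) = c ∷ rl false 1 ws
rl false c (false ∷ ws) = rl false (suc c) ws
rl false c (true ∷ ws)  = c ∷ rl true 1 ws

runsOf : List Bool → List ℕ
runsOf []       = []
runsOf (w ∷ ws) = rl w 1 ws

expand : Bool → List ℕ → List Bool
expand b []       = []
expand b (n ∷ ns) = replicate n b ++ expand (not b) ns

-- Words of the shape 1⋯0.  Run-length encoding is exact on concatenations of such words.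
Bracketed : List Bool → Set
Bracketed w = Σ (List Bool) λ xs → w ≡ true ∷ xs ++ [ false ]

lastBit : Bool → List Bool → Bool
lastBit x []       = x
lastBit x (y ∷ ys) = lastBit y ys

lastBit-snoc : (x : Bool) (xs : List Bool) (y : Bool) → lastBit x (xs ++ [ y ]) ≡ y
lastBit-snoc x []       y = refl
lastBit-snoc x (z ∷ zs) y = lastBit-snoc z zs y

replicate-snoc : (c : ℕ) (x : Bool) (zs : List Bool) → replicate c x ++ x ∷ zs ≡ x ∷ replicate c x ++ zs
replicate-snoc zero    x zs = refl
replicate-snoc (suc c) x zs = cong (x ∷_) (replicate-snoc c x zs)

expand-rl : (x : Bool) (c : ℕ) (ws : List Bool) (Q : List ℕ) →
            expand x (rl x c ws ++ Q) ≡ replicate c x ++ ws ++ expand (not (lastBit x ws)) Q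
expand-rl x     c []           Q = refl
expand-rl true  c (true ∷ ws)  Q = trans (expand-rl true (suc c) ws Q) (sym (replicate-snoc c true _))
expand-rl false c (false ∷ ws) Q = trans (expand-rl false (suc c) ws Q) (sym (replicate-snoc c false _))
expand-rl true  c (false ∷ ws) Q = cong (replicate c true ++_) (expand-rl false 1 ws Q)
expand-rl false c (true ∷ ws)  Q = cong (replicate c false ++_) (expand-rl true 1 ws Q)

expand-runsOf : (w : List Bool) → Bracketed w → (Q : List ℕ) →
                expand true (runsOf w ++ Q) ≡ w ++ expand true Q
expand-runsOf _ (xs , refl) Q rewrite expand-rl true 1 (xs ++ [ false ]) Q | lastBit-snoc true xs false = refl

rl-positive : (x : Bool) (c : ℕ) (ws : List Bool) → 1 ≤ c → All (1 ≤_) (rl x c ws)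
rl-positive x     c []           h = h ∷ []
rl-positive true  c (true ∷ ws)  h = rl-positive true (suc c) ws (s≤s z≤n)
rl-positive false c (false ∷ ws) h = rl-positive false (suc c) ws (s≤s z≤n)
rl-positive true  c (false ∷ ws) h = h ∷ rl-positive false 1 ws (s≤s z≤n)
rl-positive false c (true ∷ ws)  h = h ∷ rl-positive true 1 ws (s≤s z≤n)

runsOf-positive : (w : List Bool) → All (1 ≤_) (runsOf w)
runsOf-positive []       = []
runsOf-positive (x ∷ xs) = rl-positive x 1 xs (s≤s z≤n)

rl-nonempty : (x : Bool) (c : ℕ) (ws : List Bool) → 1 ≤ length (rl x c ws)
rl-nonempty x     c []           = s≤s z≤n
rl-nonempty true  c (true ∷ ws)  = rl-nonempty true (suc c) ws
rl-nonempty false c (false ∷ ws) = rl-nonempty false (suc c) ws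
rl-nonempty true  c (false ∷ ws) = s≤s z≤n
rl-nonempty false c (true ∷ ws)  = s≤s z≤n

runsOf-bracketed-length : (w : List Bool) → Bracketed w → 2 ≤ length (runsOf w)
runsOf-bracketed-length _ (xs , refl) = go 1 xs
  where
  go : (c : ℕ) (xs : List Bool) → 2 ≤ length (rl true c (xs ++ [ false ]))
  go c []           = s≤s (s≤s z≤n)
  go c (true ∷ ys)  = go (suc c) ys
  go c (false ∷ ys) = s≤s (rl-nonempty false 1 (ys ++ [ false ]))

rl-firstRun : (x : Bool) (c : ℕ) (ws : List Bool) (Q : List ℕ) → at 0 (rl x c ws ++ Q) 0 ≤ c + length ws
rl-firstRun x     c []           Q = m≤m+n c 0
rl-firstRun true  c (true ∷ ws)  Q = ≤-trans (rl-firstRun true (suc c) ws Q) (≤-reflexive (sym (+-suc c _)))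
rl-firstRun false c (false ∷ ws) Q = ≤-trans (rl-firstRun false (suc c) ws Q) (≤-reflexive (sym (+-suc c _)))
rl-firstRun true  c (false ∷ ws) Q = m≤m+n c _
rl-firstRun false c (true ∷ ws)  Q = m≤m+n c _

runsOf-firstRun : (w : List Bool) (Q : List ℕ) → 1 ≤ length w → at 0 (runsOf w ++ Q) 0 ≤ length w
runsOf-firstRun (x ∷ ws) Q _ = rl-firstRun x 1 ws Q

expand-≼ : (b : Bool) {ns ms : List ℕ} → ns ≼ ms → expand b ns ≼ expand b ms
expand-≼ b {[]}     {ms} _           = expand b ms , refl
expand-≼ b {n ∷ ns} (zs , refl) = ++-≼ (replicate n b) (expand-≼ (not b) {ns} (zs , refl))

expand-length : (b : Bool) (ns : List ℕ) → All (1 ≤_) ns → length ns ≤ length (expand b ns)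
expand-length b []       []       = z≤n
expand-length b (n ∷ ns) (h ∷ hs) rewrite length-++ (replicate n b) {expand (not b) ns} | length-replicate n {b} =
  +-mono-≤ h (expand-length (not b) ns hs)

-- Binary numerals

-- The least significant digits come first in bitsLSB, so its last digit is the leading 1.
bitsLSB-last : ∀ f m → 1 ≤ m → m ≤ f → Σ (List Bool) λ xs → bitsLSB f m ≡ xs ++ [ true ]
bitsLSB-last (suc zero)    (suc zero)    _ _ = [] , refl
bitsLSB-last (suc (suc f)) (suc zero)    _ _ = [] , refl
bitsLSB-last (suc f)       (suc (suc m)) _ (s≤s m<f)
  with bitsLSB-last f (suc (suc m) / 2) (m≥n⇒m/n>0 {suc (suc m)} {2} (s≤s (s≤s z≤n)))
         (≤-pred (≤-trans (m/n<m (suc (suc m)) 2 (s≤s (s≤s z≤n))) (s≤s m<f)))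
... | xs , eq = _ ∷ xs , cong (_ ∷_) eq

bin-head : ∀ m → 1 ≤ m → Σ (List Bool) λ t → bin m ≡ true ∷ t
bin-head m 1≤m with bitsLSB-last m m 1≤m ≤-refl
... | xs , eq = reverse xs , trans (cong reverse eq) (reverse-++ xs [ true ])

binLength : ℕ → ℕ
binLength v = length (bin v)

bitsLSB-length : ∀ f m → length (bitsLSB f m) ≤ m
bitsLSB-length zero    m       = z≤n
bitsLSB-length (suc f) zero    = z≤n
bitsLSB-length (suc f) (suc m) =
  s≤s (≤-trans (bitsLSB-length f (suc m / 2)) (≤-pred (m/n<m (suc m) 2 (s≤s (s≤s z≤n)))))

-- Every digit halves the number: 2·|bitsLSB f m| ≤ m + 2.
bitsLSB-length-half : ∀ f m → 2 * length (bitsLSB f m) ≤ m + 2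
bitsLSB-length-half zero    m       = z≤n
bitsLSB-length-half (suc f) zero    = z≤n
bitsLSB-length-half (suc f) (suc m) = begin
  2 * suc b      ≡⟨ *-suc 2 b ⟩
  2 + 2 * b      ≤⟨ +-monoʳ-≤ 2 (≤-trans (double≤ q b (bitsLSB-length f q) (bitsLSB-length-half f q)) 2q≤m) ⟩
  2 + suc m      ≡⟨ +-comm 2 (suc m) ⟩
  suc m + 2      ∎
  where
  open ≤-Reasoning
  q = suc m / 2
  b = length (bitsLSB f q)
  2q≤m : 2 * q ≤ suc m
  2q≤m = ≤-trans (≤-reflexive (*-comm 2 q)) (m/n*n≤m (suc m) 2)
  double≤ : ∀ q b → b ≤ q → 2 * b ≤ q + 2 → 2 * b ≤ 2 * q
  double≤ zero          b b≤q _ = *-monoʳ-≤ 2 b≤q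
  double≤ (suc zero)    b b≤q _ = *-monoʳ-≤ 2 b≤q
  double≤ q@(suc (suc _)) b _ h = begin
    2 * b  ≤⟨ h ⟩
    q + 2  ≤⟨ +-monoʳ-≤ q (s≤s (s≤s z≤n)) ⟩
    q + q  ≡⟨ cong (q +_) (sym (+-identityʳ q)) ⟩
    2 * q  ∎

binLength-half : ∀ v → 2 * binLength v ≤ v + 2
binLength-half v = subst (λ n → 2 * n ≤ v + 2) (sym (length-reverse (bitsLSB v v))) (bitsLSB-length-half v v)

-- The Knave map on run lengths

-- For S = 1^{R₀} 0^{R₁} 1^{R₂} ⋯ the output word is [R₀]0 · [R₁]1[R₂]0 · [R₃]1[R₄]0 ⋯,
-- a first block followed by groups of two blocks.  Each piece is bracketed (for R₀ ≥ 1),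
-- so the output run lengths are obtained piece by piece.

groupRuns : ℕ → ℕ → List ℕ
groupRuns m l = runsOf (bin m ++ true ∷ bin l ++ [ false ])

-- Run lengths of the groups formed by consecutive pairs of inputs (a lone last input
-- does not yet determine its group).
pairRuns : List ℕ → List ℕ
pairRuns []            = []
pairRuns (m ∷ [])      = []
pairRuns (m ∷ l ∷ rest) = groupRuns m l ++ pairRuns rest

ψ : List ℕ → List ℕ
ψ []         = []
ψ (r ∷ rest) = runsOf (bin r ++ [ false ]) ++ pairRuns rest

Ψ : (ℕ → ℕ) → ℕ → ℕ
Ψ R k = at 0 (ψ (takeS (suc k) R)) k

-- Each group [m]1[l]0 has the shape 1⋯0 (for m = 0 it is 1[l]0).
group-bracketed : ∀ m l → Bracketed (bin m ++ true ∷ bin l ++ [ false ])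
group-bracketed zero    l = bin l , refl
group-bracketed (suc m) l with bin-head (suc m) (s≤s z≤n)
... | t , eq rewrite eq = t ++ true ∷ bin l , cong (true ∷_) (sym (++-assoc t (true ∷ bin l) [ false ]))

first-bracketed : ∀ r → 1 ≤ r → Bracketed (bin r ++ [ false ])
first-bracketed r 1≤r with bin-head r 1≤r
... | t , eq rewrite eq = t , refl

ψ-positive : ∀ P → All (1 ≤_) (ψ P)
ψ-positive []         = []
ψ-positive (r ∷ rest) = ++⁺ (runsOf-positive (bin r ++ [ false ])) (pairs rest)
  where
  pairs : ∀ Q → All (1 ≤_) (pairRuns Q)
  pairs []            = []
  pairs (m ∷ [])      = []
  pairs (m ∷ l ∷ rest) = ++⁺ (runsOf-positive (bin m ++ true ∷ bin l ++ [ false ])) (pairs rest)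

pairRuns-length : ∀ Q → length Q ≤ suc (length (pairRuns Q))
pairRuns-length []             = z≤n
pairRuns-length (m ∷ [])       = s≤s z≤n
pairRuns-length (m ∷ l ∷ rest) rewrite length-++ (groupRuns m l) {pairRuns rest} =
  ≤-trans (s≤s (s≤s (pairRuns-length rest)))
          (s≤s (+-monoˡ-≤ (length (pairRuns rest)) (runsOf-bracketed-length _ (group-bracketed m l))))

ψ-length : ∀ r rest → 1 ≤ r → length (r ∷ rest) ≤ length (ψ (r ∷ rest))
ψ-length r rest 1≤r rewrite length-++ (runsOf (bin r ++ [ false ])) {pairRuns rest} =
  ≤-trans (s≤s (pairRuns-length rest))
          (+-monoˡ-≤ (length (pairRuns rest)) (runsOf-bracketed-length _ (first-bracketed r 1≤r)))

ψ-takeS-length : ∀ n R → 1 ≤ R 0 → n ≤ length (ψ (takeS n R))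
ψ-takeS-length zero    R _   = z≤n
ψ-takeS-length (suc n) R 1≤R =
  ≤-trans (≤-reflexive (cong suc (sym (takeS-length n (λ i → R (suc i))))))
          (ψ-length (R 0) (takeS n (λ i → R (suc i))) 1≤R)

ψ-≼ : {P P′ : List ℕ} → P ≼ P′ → ψ P ≼ ψ P′
ψ-≼ {[]}       {P′} _           = ψ P′ , refl
ψ-≼ {r ∷ rest} (zs , refl) = ++-≼ (runsOf (bin r ++ [ false ])) (pairs rest zs)
  where
  pairs : ∀ xs ys → pairRuns xs ≼ pairRuns (xs ++ ys)
  pairs []            ys = pairRuns ys , refl
  pairs (m ∷ [])      ys = pairRuns (m ∷ ys) , refl
  pairs (m ∷ l ∷ rest) ys = ++-≼ (groupRuns m l) (pairs rest ys)

Ψ-causal : ∀ R k M → 1 ≤ R 0 → k < length (ψ (takeS M R)) → Ψ R k ≡ at 0 (ψ (takeS M R)) k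
Ψ-causal R k M 1≤R k<ψ = ≼-compare 0 k comparable (ψ-takeS-length (suc k) R 1≤R) k<ψ
  where
  comparable = ≼-comparable (λ j → ψ (takeS j R)) (λ j≤j′ → ψ-≼ (takeS-≼ R j≤j′)) (suc k) M

Ψ-positive : ∀ R k → 1 ≤ R 0 → 1 ≤ Ψ R k
Ψ-positive R k 1≤R = go (ψ (takeS (suc k) R)) k (ψ-positive (takeS (suc k) R)) (ψ-takeS-length (suc k) R 1≤R)
  where
  go : ∀ xs k → All (1 ≤_) xs → k < length xs → 1 ≤ at 0 xs k
  go (x ∷ xs) zero    (px ∷ _)  _       = px
  go (x ∷ xs) (suc k) (_ ∷ pxs) (s≤s h) = go xs k pxs h

-- Sequences given by their run lengths

alternate : Bool → ℕ → Bool
alternate b zero    = b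
alternate b (suc i) = alternate (not b) i

alternate-suc : ∀ b i → alternate b (suc i) ≡ not (alternate b i)
alternate-suc b zero    = refl
alternate-suc b (suc i) = alternate-suc (not b) i

psum : (ℕ → ℕ) → ℕ → ℕ
psum Q zero    = 0
psum Q (suc i) = Q 0 + psum (λ j → Q (suc j)) i

psum-snoc : ∀ Q i → psum Q (suc i) ≡ psum Q i + Q i
psum-snoc Q zero    = +-comm (Q 0) 0
psum-snoc Q (suc i) = trans (cong (Q 0 +_) (psum-snoc (λ j → Q (suc j)) i)) (sym (+-assoc (Q 0) _ _))

psum-≥ : ∀ Q → (∀ i → 1 ≤ Q i) → ∀ i → i ≤ psum Q i
psum-≥ Q pos zero    = z≤n
psum-≥ Q pos (suc i) = +-mono-≤ (pos 0) (psum-≥ _ (λ j → pos (suc j)) i)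

-- The sequence 1^{Q₀} 0^{Q₁} 1^{Q₂} ⋯ with run lengths Q (position n lies in the first n+1 runs).
seqOf : (ℕ → ℕ) → Seq
seqOf Q n = at false (expand true (takeS (suc n) Q)) n

seqOf-cong : ∀ Q Q′ → (∀ i → Q i ≡ Q′ i) → seqOf Q ≗ˢ seqOf Q′
seqOf-cong Q Q′ Q≡ n = cong (λ P → at false (expand true P) n) (takeS-cong (suc n) Q Q′ (λ i _ → Q≡ i))

at-replicate : (b : Bool) (n t : ℕ) (ys : List Bool) → t < n → at false (replicate n b ++ ys) t ≡ b
at-replicate b (suc n) zero    ys _       = refl
at-replicate b (suc n) (suc t) ys (s≤s h) = at-replicate b n t ys h

at-replicate-++ʳ : (b : Bool) (n k : ℕ) (ys : List Bool) → at false (replicate n b ++ ys) (n + k) ≡ at false ys k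
at-replicate-++ʳ b zero    k ys = refl
at-replicate-++ʳ b (suc n) k ys = at-replicate-++ʳ b n k ys

expand-inRun : ∀ Q b M i t → i < M → t < Q i → at false (expand b (takeS M Q)) (psum Q i + t) ≡ alternate b i
expand-inRun Q b (suc M) zero    t _         t<Q = at-replicate b (Q 0) t _ t<Q
expand-inRun Q b (suc M) (suc i) t (s≤s i<M) t<Q = begin
  at false W (Q 0 + psum Q′ i + t)   ≡⟨ cong (at false W) (+-assoc (Q 0) (psum Q′ i) t) ⟩
  at false W (Q 0 + (psum Q′ i + t)) ≡⟨ at-replicate-++ʳ b (Q 0) (psum Q′ i + t) _ ⟩
  at false (expand (not b) (takeS M Q′)) (psum Q′ i + t) ≡⟨ expand-inRun Q′ (not b) M i t i<M t<Q ⟩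
  alternate (not b) i ∎
  where
  open ≡-Reasoning
  Q′ : ℕ → ℕ
  Q′ j = Q (suc j)
  W : List Bool
  W = replicate (Q 0) b ++ expand (not b) (takeS M Q′)

∸-within : ∀ {a n c} → a ≤ n → n < a + c → n ∸ a < c
∸-within {a} {n} {c} a≤n n<a+c = +-cancelˡ-< a (n ∸ a) c (subst (_< a + c) (sym (m+[n∸m]≡n a≤n)) n<a+c)

seqOf-inRun : ∀ Q → (∀ i → 1 ≤ Q i) → ∀ i n → psum Q i ≤ n → n < psum Q (suc i) → seqOf Q n ≡ alternate true i
seqOf-inRun Q pos i n start≤n n<end = begin
  seqOf Q n                ≡⟨ cong (seqOf Q) (sym (m+[n∸m]≡n start≤n)) ⟩
  seqOf Q (psum Q i + t)   ≡⟨ expand-inRun Q true (suc (psum Q i + t)) i t (s≤s i≤) t<Q ⟩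
  alternate true i         ∎
  where
  open ≡-Reasoning
  t = n ∸ psum Q i
  t<Q : t < Q i
  t<Q = ∸-within start≤n (subst (n <_) (psum-snoc Q i) n<end)
  i≤ : i ≤ psum Q i + t
  i≤ = ≤-trans (psum-≥ Q pos i) (m≤m+n (psum Q i) t)

seqOf-runs : ∀ Q → (∀ i → 1 ≤ Q i) → Runs (seqOf Q) (psum Q)
seqOf-runs Q pos = refl , increasing , constant , changes
  where
  increasing : ∀ i → psum Q i < psum Q (suc i)
  increasing i = subst (psum Q i <_) (sym (psum-snoc Q i))
                   (subst (_≤ psum Q i + Q i) (+-comm (psum Q i) 1) (+-monoʳ-≤ (psum Q i) (pos i)))
  atStart : ∀ i → seqOf Q (psum Q i) ≡ alternate true i
  atStart i = seqOf-inRun Q pos i (psum Q i) ≤-refl (increasing i)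
  constant : ∀ i j → psum Q i ≤ j → j < psum Q (suc i) → seqOf Q j ≡ seqOf Q (psum Q i)
  constant i j start≤j j<end = trans (seqOf-inRun Q pos i j start≤j j<end) (sym (atStart i))
  changes : ∀ i → seqOf Q (psum Q (suc i)) ≢ seqOf Q (psum Q i)
  changes i eq = not-¬ refl (sym (trans (sym (alternate-suc true i)) (trans (sym (atStart (suc i))) (trans eq (atStart i)))))

locate : ∀ (p : ℕ → ℕ) → p 0 ≡ 0 → (∀ i → p i < p (suc i)) → ∀ n → Σ ℕ λ i → p i ≤ n × n < p (suc i)
locate p p0 inc zero    = 0 , ≤-reflexive p0 , subst (_< p 1) p0 (inc 0)
locate p p0 inc (suc n) with locate p p0 inc n
... | i , p≤n , n<p with suc n <? p (suc i)
...   | yes sn<p = i , m≤n⇒m≤1+n p≤n , sn<p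
...   | no  sn≮p = suc i , ≮⇒≥ sn≮p , ≤-trans (s≤s (≤-reflexive (≤-antisym n<p (≮⇒≥ sn≮p)))) (inc (suc i))

seqOf-notEventuallyConstant : ∀ Q → (∀ i → 1 ≤ Q i) → NotEventuallyConstant (seqOf Q)
seqOf-notEventuallyConstant Q pos n with seqOf-runs Q pos
... | p0 , inc , constant , changes with locate (psum Q) p0 inc n
...   | i , start≤n , n<end = psum Q (suc i) , <⇒≤ n<end , λ eq → changes i (trans eq (constant i n start≤n n<end))

-- The run decomposition of an arbitrary sequence

Runs-unique : ∀ S p q → Runs S p → Runs S q → ∀ i → p i ≡ q i
Runs-unique S p q (p0 , _ , _ , _) (q0 , _ , _ , _) zero = trans p0 (sym q0)
Runs-unique S p q rp@(_ , pinc , pconst , pchange) rq@(_ , qinc , qconst , qchange) (suc i)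
  with Runs-unique S p q rp rq i | <-cmp (p (suc i)) (q (suc i))
... | _   | tri≈ _ eq _ = eq
... | p≡q | tri< p<q _ _ =
  ⊥-elim (pchange i (trans (qconst i (p (suc i)) (≤-trans (≤-reflexive (sym p≡q)) (<⇒≤ (pinc i))) p<q) (sym (cong S p≡q))))
... | p≡q | tri> _ _ q<p =
  ⊥-elim (qchange i (trans (pconst i (q (suc i)) (≤-trans (≤-reflexive p≡q) (<⇒≤ (qinc i))) q<p) (cong S p≡q)))

Runs-≗ : ∀ S S′ p → S ≗ˢ S′ → Runs S p → Runs S′ p
Runs-≗ S S′ p S≗S′ (p0 , inc , constant , changes) =
  p0 , inc ,
  (λ i j start≤j j<end → trans (sym (S≗S′ j)) (trans (constant i j start≤j j<end) (S≗S′ (p i)))) ,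
  (λ i eq → changes i (trans (S≗S′ (p (suc i))) (trans eq (sym (S≗S′ (p i))))))

runLengths : (ℕ → ℕ) → ℕ → ℕ
runLengths p i = p (suc i) ∸ p i

runLengths-positive : ∀ S p → Runs S p → ∀ i → 1 ≤ runLengths p i
runLengths-positive S p (_ , inc , _ , _) i = m<n⇒0<n∸m (inc i)

starts-psum : ∀ S p → Runs S p → ∀ i → p i ≡ psum (runLengths p) i
starts-psum S p (p0 , _ , _ , _) zero = p0
starts-psum S p r@(_ , inc , _ , _) (suc i) = begin
  p (suc i)                                       ≡⟨ sym (m+[n∸m]≡n (<⇒≤ (inc i))) ⟩
  p i + runLengths p i                            ≡⟨ cong (_+ runLengths p i) (starts-psum S p r i) ⟩
  psum (runLengths p) i + runLengths p i          ≡⟨ sym (psum-snoc (runLengths p) i) ⟩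
  psum (runLengths p) (suc i)                     ∎
  where open ≡-Reasoning

runBits : ∀ S p → Runs S p → S 0 ≡ true → ∀ i → S (p i) ≡ alternate true i
runBits S p (p0 , _ , _ , _) S0 zero = trans (cong S p0) S0
runBits S p r@(_ , _ , _ , changes) S0 (suc i) =
  trans (¬-not (changes i)) (trans (cong not (runBits S p r S0 i)) (sym (alternate-suc true i)))

seqOf-runLengths : ∀ S p → Runs S p → S 0 ≡ true → S ≗ˢ seqOf (runLengths p)
seqOf-runLengths S p r@(p0 , inc , constant , _) S0 n with locate p p0 inc n
... | i , start≤n , n<end =
  trans (constant i n start≤n n<end)
  (trans (runBits S p r S0 i)
  (sym (seqOf-inRun (runLengths p) (runLengths-positive S p r) i n
          (subst (_≤ n) (starts-psum S p r i) start≤n)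
          (subst (n <_) (starts-psum S p r (suc i)) n<end))))

concatBlocks : (ℕ → List Bool) → ℕ → List Bool
concatBlocks w zero    = []
concatBlocks w (suc j) = w 0 ++ concatBlocks (λ i → w (suc i)) j

concatBlocks-snoc : ∀ w j → concatBlocks w (suc j) ≡ concatBlocks w j ++ w j
concatBlocks-snoc w zero    = ++-identityʳ (w 0)
concatBlocks-snoc w (suc j) =
  trans (cong (w 0 ++_) (concatBlocks-snoc (λ i → w (suc i)) j)) (sym (++-assoc (w 0) _ _))

concatBlocks-cong : ∀ w w′ → (∀ i → w i ≡ w′ i) → ∀ j → concatBlocks w j ≡ concatBlocks w′ j
concatBlocks-cong w w′ w≡ zero    = refl
concatBlocks-cong w w′ w≡ (suc j) = cong₂ _++_ (w≡ 0) (concatBlocks-cong _ _ (λ i → w≡ (suc i)) j)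

concatBlocks-≼ : ∀ w {j j′} → j ≤ j′ → concatBlocks w j ≼ concatBlocks w j′
concatBlocks-≼ w z≤n       = _ , refl
concatBlocks-≼ w (s≤s j≤j′) = ++-≼ (w 0) (concatBlocks-≼ (λ i → w (suc i)) j≤j′)

concatBlocks-length : ∀ w → (∀ i → 1 ≤ length (w i)) → ∀ j → j ≤ length (concatBlocks w j)
concatBlocks-length w nonempty zero    = z≤n
concatBlocks-length w nonempty (suc j) rewrite length-++ (w 0) {concatBlocks (λ i → w (suc i)) j} =
  +-mono-≤ (nonempty 0) (concatBlocks-length _ (λ i → nonempty (suc i)) j)

offset-length : ∀ w j → offset w j ≡ length (concatBlocks w j)
offset-length w zero    = refl
offset-length w (suc j) = begin
  offset w j + length (w j)                      ≡⟨ cong (_+ length (w j)) (offset-length w j) ⟩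
  length (concatBlocks w j) + length (w j)       ≡⟨ sym (length-++ (concatBlocks w j)) ⟩
  length (concatBlocks w j ++ w j)               ≡⟨ cong length (sym (concatBlocks-snoc w j)) ⟩
  length (concatBlocks w (suc j))                ∎
  where open ≡-Reasoning

AgreesWithConcat : (ℕ → List Bool) → Seq → Set
AgreesWithConcat w T = ∀ j n → n < length (concatBlocks w j) → T n ≡ at false (concatBlocks w j) n

concat-agrees : ∀ w T → IsConcat w T → AgreesWithConcat w T
concat-agrees w T concat zero    n ()
concat-agrees w T concat (suc j) n n<C rewrite concatBlocks-snoc w j with n <? length (concatBlocks w j)
... | yes n<Cj = trans (concat-agrees w T concat j n n<Cj) (sym (≼-at false n (≼-++ (concatBlocks w j) (w j)) n<Cj))
... | no  n≮Cj = begin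
  T n                                        ≡⟨ cong T (sym (m+[n∸m]≡n Cj≤n)) ⟩
  T (length (concatBlocks w j) + t)          ≡⟨ cong (λ o → T (o + t)) (sym (offset-length w j)) ⟩
  T (offset w j + t)                         ≡⟨ concat j t t<w ⟩
  lookup (w j) (fromℕ< t<w)                  ≡⟨ lookup-at false (w j) t t<w ⟩
  at false (w j) t                           ≡⟨ sym (at-++ʳ false (concatBlocks w j) (w j) t) ⟩
  at false (concatBlocks w j ++ w j) (length (concatBlocks w j) + t) ≡⟨ cong (at false (concatBlocks w j ++ w j)) (m+[n∸m]≡n Cj≤n) ⟩
  at false (concatBlocks w j ++ w j) n       ∎
  where
  open ≡-Reasoning
  Cj≤n = ≮⇒≥ n≮Cj
  t = n ∸ length (concatBlocks w j)
  t<w : t < length (w j)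
  t<w = ∸-within Cj≤n (subst (n <_) (length-++ (concatBlocks w j)) n<C)

agrees-concat : ∀ w T → AgreesWithConcat w T → IsConcat w T
agrees-concat w T agrees i t t<w = begin
  T (offset w i + t)                                        ≡⟨ agrees (suc i) _ inside ⟩
  at false (concatBlocks w (suc i)) (offset w i + t)        ≡⟨ cong₂ (at false) (concatBlocks-snoc w i) (cong (_+ t) (offset-length w i)) ⟩
  at false (concatBlocks w i ++ w i) (length (concatBlocks w i) + t) ≡⟨ at-++ʳ false (concatBlocks w i) (w i) t ⟩
  at false (w i) t                                          ≡⟨ sym (lookup-at false (w i) t t<w) ⟩
  lookup (w i) (fromℕ< t<w)                                 ∎
  where
  open ≡-Reasoning
  inside : offset w i + t < length (concatBlocks w (suc i))
  inside rewrite concatBlocks-snoc w i | length-++ (concatBlocks w i) {w i} | offset-length w i =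
    +-monoʳ-< (length (concatBlocks w i)) t<w

-- The Knave map in terms of run lengths

outBlock : Bool → (ℕ → ℕ) → ℕ → List Bool
outBlock b R i = bin (R i) ++ [ not (alternate b i) ]

snoc-nonempty : (xs : List Bool) (b : Bool) → 1 ≤ length (xs ++ [ b ])
snoc-nonempty []       b = s≤s z≤n
snoc-nonempty (x ∷ xs) b = s≤s z≤n

outBlock-nonempty : ∀ b R i → 1 ≤ length (outBlock b R i)
outBlock-nonempty b R i = snoc-nonempty (bin (R i)) (not (alternate b i))

groups-expand : ∀ n R → concatBlocks (outBlock false R) (n + n) ≡ expand true (pairRuns (takeS (n + n) R))
groups-expand zero    R = refl
groups-expand (suc n) R rewrite +-suc n n = begin
  (bin (R 0) ++ [ true ]) ++ (bin (R 1) ++ [ false ]) ++ C ≡⟨ ++-assoc (bin (R 0)) [ true ] _ ⟩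
  bin (R 0) ++ true ∷ (bin (R 1) ++ [ false ]) ++ C      ≡⟨ sym (++-assoc (bin (R 0)) (true ∷ bin (R 1) ++ [ false ]) C) ⟩
  group ++ C                                             ≡⟨ cong (group ++_) (groups-expand n R′) ⟩
  group ++ expand true (pairRuns (takeS (n + n) R′))     ≡⟨ sym (expand-runsOf group (group-bracketed (R 0) (R 1)) _) ⟩
  expand true (pairRuns (takeS (suc (suc (n + n))) R))   ∎
  where
  open ≡-Reasoning
  R′ : ℕ → ℕ
  R′ i = R (suc (suc i))
  C = concatBlocks (outBlock false R′) (n + n)
  group = bin (R 0) ++ true ∷ bin (R 1) ++ [ false ]

outBlocks-expand : ∀ n R → 1 ≤ R 0 →
                   concatBlocks (outBlock true R) (suc (n + n)) ≡ expand true (ψ (takeS (suc (n + n)) R))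
outBlocks-expand n R 1≤R = begin
  first ++ concatBlocks (outBlock false R′) (n + n)        ≡⟨ cong (first ++_) (groups-expand n R′) ⟩
  first ++ expand true (pairRuns (takeS (n + n) R′))      ≡⟨ sym (expand-runsOf first (first-bracketed (R 0) 1≤R) _) ⟩
  expand true (ψ (takeS (suc (n + n)) R))                 ∎
  where
  open ≡-Reasoning
  R′ : ℕ → ℕ
  R′ i = R (suc i)
  first = bin (R 0) ++ [ false ]

outBlocks-Ψ : ∀ R → 1 ≤ R 0 → AgreesWithConcat (outBlock true R) (seqOf (Ψ R))
outBlocks-Ψ R 1≤R J n n<CJ = begin
  seqOf (Ψ R) n                                     ≡⟨ sym (≼-at false n expand≼ n<expand) ⟩
  at false (expand true (ψ (takeS m R))) n          ≡⟨ cong (λ W → at false W n) (sym (outBlocks-expand n R 1≤R)) ⟩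
  at false (concatBlocks (outBlock true R) m) n     ≡⟨ ≼-compare false n comparable n<Cm n<CJ ⟩
  at false (concatBlocks (outBlock true R) J) n     ∎
  where
  open ≡-Reasoning
  m = suc (n + n)
  n<m : n < m
  n<m = s≤s (m≤m+n n n)
  m≤ψ : m ≤ length (ψ (takeS m R))
  m≤ψ = ψ-takeS-length m R 1≤R
  prefix : takeS (suc n) (Ψ R) ≼ ψ (takeS m R)
  prefix = takeS-≼-list 0 (suc n) (Ψ R) (ψ (takeS m R))
             (λ k k≤n → Ψ-causal R k m 1≤R (≤-trans (≤-trans k≤n n<m) m≤ψ)) (≤-trans n<m m≤ψ)
  expand≼ : expand true (takeS (suc n) (Ψ R)) ≼ expand true (ψ (takeS m R))
  expand≼ = expand-≼ true prefix
  n<expand : n < length (expand true (takeS (suc n) (Ψ R)))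
  n<expand = ≤-trans (≤-reflexive (sym (takeS-length (suc n) (Ψ R))))
               (expand-length true _ (takeS-positive (suc n) (Ψ R) (λ k → Ψ-positive R k 1≤R)))
  comparable = ≼-comparable (concatBlocks (outBlock true R)) (concatBlocks-≼ (outBlock true R)) m J
  n<Cm : n < length (concatBlocks (outBlock true R) m)
  n<Cm = ≤-trans n<m (concatBlocks-length (outBlock true R) (outBlock-nonempty true R) m)

agrees-cong : ∀ w w′ T T′ → (∀ i → w i ≡ w′ i) → T ≗ˢ T′ → AgreesWithConcat w T → AgreesWithConcat w′ T′
agrees-cong w w′ T T′ w≡ T≗ agrees j n n<C′ =
  trans (sym (T≗ n)) (trans (agrees j n (subst (λ C → n < length C) (sym C≡) n<C′)) (cong (λ C → at false C n) C≡))
  where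
  C≡ = concatBlocks-cong w w′ w≡ j

runLengths-psum : ∀ Q i → runLengths (psum Q) i ≡ Q i
runLengths-psum Q i = trans (cong (_∸ psum Q i) (psum-snoc Q i)) (m+n∸m≡n (psum Q i) (Q i))

block-outBlock : ∀ S p → Runs S p → S 0 ≡ true → ∀ i → block S p i ≡ outBlock true (runLengths p) i
block-outBlock S p r S0 i = cong (λ b → bin (runLengths p i) ++ [ not b ]) (runBits S p r S0 i)

knave-seqOf : ∀ S T p → Runs S p → IsConcat (block S p) T → S 0 ≡ true → T ≗ˢ seqOf (Ψ (runLengths p))
knave-seqOf S T p r concat S0 n =
  trans (agreesT (suc n) n n<C) (sym (outBlocks-Ψ R (runLengths-positive S p r 0) (suc n) n n<C))
  where
  R = runLengths p
  agreesT : AgreesWithConcat (outBlock true R) T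
  agreesT = agrees-cong _ _ T T (block-outBlock S p r S0) (λ _ → refl) (concat-agrees _ T concat)
  n<C : n < length (concatBlocks (outBlock true R) (suc n))
  n<C = concatBlocks-length (outBlock true R) (outBlock-nonempty true R) (suc n)

knave-runLengths : ∀ S T p q → Runs S p → IsConcat (block S p) T → S 0 ≡ true → Runs T q →
                   ∀ i → runLengths q i ≡ Ψ (runLengths p) i
knave-runLengths S T p q r concat S0 rT i =
  trans (cong₂ _∸_ (q≡ (suc i)) (q≡ i)) (runLengths-psum Q i)
  where
  Q = Ψ (runLengths p)
  runsT : Runs T (psum Q)
  runsT = Runs-≗ (seqOf Q) T (psum Q) (λ n → sym (knave-seqOf S T p r concat S0 n))
            (seqOf-runs Q (λ k → Ψ-positive (runLengths p) k (runLengths-positive S p r 0)))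
  q≡ : ∀ j → q j ≡ psum Q j
  q≡ = Runs-unique T q (psum Q) rT runsT

knave-startsWith1 : ∀ S T p → Runs S p → IsConcat (block S p) T → T 0 ≡ true
knave-startsWith1 S T p r concat with bin-head (runLengths p 0) (runLengths-positive S p r 0)
... | t , bin≡ = begin
  T 0                               ≡⟨ concat 0 0 0<block ⟩
  lookup (block S p 0) (fromℕ< 0<block) ≡⟨ lookup-at false (block S p 0) 0 0<block ⟩
  at false (block S p 0) 0          ≡⟨ cong (λ ws → at false (ws ++ [ not (S (p 0)) ]) 0) bin≡ ⟩
  true                              ∎
  where
  open ≡-Reasoning
  0<block : 0 < length (block S p 0)
  0<block = snoc-nonempty (bin (runLengths p 0)) (not (S (p 0)))

knave-intro : ∀ R Q → (∀ i → 1 ≤ R i) → (∀ i → Q i ≡ Ψ R i) → Knave (seqOf R) (seqOf Q)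
knave-intro R Q pos Q≡ = psum R , runs , agrees-concat _ (seqOf Q) agrees
  where
  runs = seqOf-runs R pos
  startsWith1 : seqOf R 0 ≡ true
  startsWith1 = seqOf-inRun R pos 0 0 z≤n (subst (0 <_) (sym (+-identityʳ (R 0))) (pos 0))
  blocks≡ : ∀ i → outBlock true R i ≡ block (seqOf R) (psum R) i
  blocks≡ i = sym (trans (block-outBlock (seqOf R) (psum R) runs startsWith1 i)
                         (cong (λ m → bin m ++ [ not (alternate true i) ]) (runLengths-psum R i)))
  agrees : AgreesWithConcat (block (seqOf R) (psum R)) (seqOf Q)
  agrees = agrees-cong _ _ _ _ blocks≡ (λ n → sym (seqOf-cong Q (Ψ R) Q≡ n)) (outBlocks-Ψ R (pos 0))

-- Construction of the 2-cycle on run lengths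

-- For the odd prefixes of length k that occur,
-- ψ already reaches index k except at k = 0, 2, 4, where the value is seeded with the
-- one that the uniqueness argument forces.
nextEven : ℕ → List ℕ → ℕ
nextEven 0 _ = 1
nextEven 2 _ = 3
nextEven 4 _ = 3
nextEven k O = at 0 (ψ O) k

-- One step of the course-of-values recursion: extend the even prefix, then the odd one
-- (the k-th odd run is Ψ of the first k+1 even runs).
grow : ℕ → List ℕ × List ℕ → List ℕ × List ℕ
grow k (E , O) = E′ , O ++ [ at 0 (ψ E′) k ]
  where
  E′ : List ℕ
  E′ = E ++ [ nextEven k O ]

prefixes : ℕ → List ℕ × List ℕ
prefixes zero    = [] , []
prefixes (suc k) = grow k (prefixes k)

runsEven runsOdd : ℕ → ℕ
runsEven k = at 0 (proj₁ (prefixes (suc k))) k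
runsOdd  k = at 0 (proj₂ (prefixes (suc k))) k

at-snoc : (xs : List ℕ) (x k : ℕ) → length xs ≡ k → at 0 (xs ++ [ x ]) k ≡ x
at-snoc xs x k refl = trans (cong (at 0 (xs ++ [ x ])) (sym (+-identityʳ (length xs)))) (at-++ʳ 0 xs [ x ] 0)

prefixes-length : ∀ k → length (proj₁ (prefixes k)) ≡ k × length (proj₂ (prefixes k)) ≡ k
prefixes-length zero    = refl , refl
prefixes-length (suc k) =
  trans (length-++ (proj₁ (prefixes k))) (trans (+-comm _ 1) (cong suc (proj₁ (prefixes-length k)))) ,
  trans (length-++ (proj₂ (prefixes k))) (trans (+-comm _ 1) (cong suc (proj₂ (prefixes-length k))))

prefixes-takeS : ∀ k → proj₁ (prefixes k) ≡ takeS k runsEven × proj₂ (prefixes k) ≡ takeS k runsOdd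
prefixes-takeS zero    = refl , refl
prefixes-takeS (suc k) =
  snoc-takeS runsEven (proj₁ (prefixes-takeS k)) (sym (at-snoc (proj₁ (prefixes k)) _ k (proj₁ (prefixes-length k)))) ,
  snoc-takeS runsOdd  (proj₂ (prefixes-takeS k)) (sym (at-snoc (proj₂ (prefixes k)) _ k (proj₂ (prefixes-length k))))
  where
  snoc-takeS : ∀ {xs x} f → xs ≡ takeS k f → x ≡ f k → xs ++ [ x ] ≡ takeS (suc k) f
  snoc-takeS f refl refl = sym (takeS-snoc k f)

runsEven-next : ∀ k → runsEven k ≡ nextEven k (takeS k runsOdd)
runsEven-next k = trans (at-snoc (proj₁ (prefixes k)) _ k (proj₁ (prefixes-length k)))
                        (cong (nextEven k) (proj₂ (prefixes-takeS k)))

runsOdd-Ψ : ∀ k → runsOdd k ≡ Ψ runsEven k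
runsOdd-Ψ k = trans (at-snoc (proj₂ (prefixes k)) _ k (proj₂ (prefixes-length k)))
                    (cong (λ E → at 0 (ψ E) k) (proj₁ (prefixes-takeS (suc k))))

runsOdd-ahead : ∀ d → 5 + d < length (ψ (takeS (5 + d) runsOdd))
runsOdd-ahead d = s≤s (s≤s (s≤s (s≤s (s≤s (s≤s (≤-trans d≤ (n≤1+n _)))))))
  where
  Q = takeS d (λ i → runsOdd (5 + i))
  d≤ : d ≤ suc (length (pairRuns Q))
  d≤ = subst (_≤ suc (length (pairRuns Q))) (takeS-length d _) (pairRuns-length Q)

-- The even run lengths are Ψ of the odd ones: at the seeded positions by computation,
-- elsewhere by causality.
runsEven-Ψ : ∀ k → runsEven k ≡ Ψ runsOdd k
runsEven-Ψ 0 = refl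
runsEven-Ψ 1 = refl
runsEven-Ψ 2 = refl
runsEven-Ψ 3 = refl
runsEven-Ψ 4 = refl
runsEven-Ψ k@(suc (suc (suc (suc (suc d))))) =
  trans (runsEven-next k) (sym (Ψ-causal runsOdd k k (s≤s z≤n) (runsOdd-ahead d)))

runsEven-positive : ∀ k → 1 ≤ runsEven k
runsEven-positive k = subst (1 ≤_) (sym (runsEven-Ψ k)) (Ψ-positive runsOdd k (s≤s z≤n))

runsOdd-positive : ∀ k → 1 ≤ runsOdd k
runsOdd-positive k = subst (1 ≤_) (sym (runsOdd-Ψ k)) (Ψ-positive runsEven k (s≤s z≤n))

-- Uniqueness of the 2-cycle on run lengths

TwoCycle : (ℕ → ℕ) → (ℕ → ℕ) → Set
TwoCycle X Y = (∀ k → X k ≡ Ψ Y k) × (∀ k → Y k ≡ Ψ X k)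

AgreeBelow : (ℕ → ℕ) → (ℕ → ℕ) → ℕ → Set
AgreeBelow X Y n = ∀ i → i < n → X i ≡ runsEven i × Y i ≡ runsOdd i

below-snoc : {P : ℕ → Set} (n : ℕ) → (∀ i → i < n → P i) → P n → ∀ i → i < suc n → P i
below-snoc n below Pn i (s≤s i≤n) with i ≟ n
... | yes refl = Pn
... | no  i≢n  = below i (≤∧≢⇒< i≤n i≢n)

agree-snoc : ∀ {X Y n} → AgreeBelow X Y n → X n ≡ runsEven n → Y n ≡ runsOdd n → AgreeBelow X Y (suc n)
agree-snoc {n = n} agree Xn Yn = below-snoc n agree (Xn , Yn)

-- The first two runs of both sequences are 1, 1, so agreement below 2 is symmetric.
agree-swap₂ : ∀ {X Y} → AgreeBelow X Y 2 → AgreeBelow Y X 2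
agree-swap₂ agree 0 _ = proj₂ (agree 0 (s≤s z≤n)) , proj₁ (agree 0 (s≤s z≤n))
agree-swap₂ agree 1 _ = proj₂ (agree 1 (s≤s (s≤s z≤n))) , proj₁ (agree 1 (s≤s (s≤s z≤n)))
agree-swap₂ agree (suc (suc i)) (s≤s (s≤s ()))

forced-step : ∀ {X Y n} → TwoCycle X Y → AgreeBelow X Y n → n < length (ψ (takeS n runsOdd)) → X n ≡ runsEven n
forced-step {n = zero} _ _ ()
forced-step {X} {Y} {n@(suc _)} (X≡ , _) agree ahead = begin
  X n                            ≡⟨ X≡ n ⟩
  Ψ Y n                          ≡⟨ Ψ-causal Y n n Y0≥1 (subst (λ P → n < length (ψ P)) (sym prefix) ahead) ⟩
  at 0 (ψ (takeS n Y)) n         ≡⟨ cong (λ P → at 0 (ψ P) n) prefix ⟩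
  at 0 (ψ (takeS n runsOdd)) n   ≡⟨ sym (Ψ-causal runsOdd n n (runsOdd-positive 0) ahead) ⟩
  Ψ runsOdd n                    ≡⟨ sym (runsEven-Ψ n) ⟩
  runsEven n                     ∎
  where
  open ≡-Reasoning
  prefix : takeS n Y ≡ takeS n runsOdd
  prefix = takeS-cong n Y runsOdd (λ i i<n → proj₂ (agree i i<n))
  Y0≥1 : 1 ≤ Y 0
  Y0≥1 = subst (1 ≤_) (sym (proj₂ (agree 0 (s≤s z≤n)))) (runsOdd-positive 0)

-- Y n only depends on X up to n.
follow-step : ∀ {X Y n} → TwoCycle X Y → AgreeBelow X Y n → X n ≡ runsEven n → Y n ≡ runsOdd n
follow-step {X} {Y} {n} (_ , Y≡) agree Xn = begin
  Y n                            ≡⟨ Y≡ n ⟩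
  Ψ X n                          ≡⟨ cong (λ P → at 0 (ψ P) n) prefix ⟩
  Ψ runsEven n                   ≡⟨ sym (runsOdd-Ψ n) ⟩
  runsOdd n                      ∎
  where
  open ≡-Reasoning
  prefix : takeS (suc n) X ≡ takeS (suc n) runsEven
  prefix = takeS-cong (suc n) X runsEven (below-snoc n (λ i i<n → proj₁ (agree i i<n)) Xn)

next : List ℕ → ℕ → ℕ → ℕ
next P n v = at 0 (ψ (P ++ [ v ])) n

circular-step : ∀ {X Y n} → TwoCycle X Y → AgreeBelow X Y n →
                X n ≡ next (takeS n runsOdd) n (Y n) × Y n ≡ next (takeS n runsEven) n (X n)
circular-step {X} {Y} {n} (X≡ , Y≡) agree =
  trans (X≡ n) (cong (λ P → at 0 (ψ P) n) (prefix Y runsOdd proj₂)) ,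
  trans (Y≡ n) (cong (λ P → at 0 (ψ P) n) (prefix X runsEven proj₁))
  where
  prefix : ∀ Z R → (∀ {i} → X i ≡ runsEven i × Y i ≡ runsOdd i → Z i ≡ R i) → takeS (suc n) Z ≡ takeS n R ++ [ Z n ]
  prefix Z R pick = trans (takeS-snoc n Z) (cong (_++ [ Z n ]) (takeS-cong n Z R (λ i i<n → pick (agree i i<n))))

-- At the circular positions the new value is the first run of u [v] 0 with |u| ≤ 3.
HeadBound : (ℕ → ℕ) → Set
HeadBound F = ∀ v → F v ≤ 4 + binLength v

headBound : ∀ (u : List Bool) → length u ≤ 3 → HeadBound (λ v → at 0 (runsOf (u ++ bin v ++ [ false ]) ++ []) 0)
headBound u u≤3 v = begin
  at 0 (runsOf w ++ []) 0          ≤⟨ runsOf-firstRun w [] (≤-trans (snoc-nonempty (bin v) false) (length-++-≤ʳ (bin v ++ [ false ]) {u})) ⟩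
  length w                         ≡⟨ length-++ u ⟩
  length u + length (bin v ++ [ false ]) ≡⟨ cong (length u +_) (trans (length-++ (bin v)) (+-comm (binLength v) 1)) ⟩
  length u + suc (binLength v)     ≤⟨ +-monoˡ-≤ (suc (binLength v)) u≤3 ⟩
  4 + binLength v                  ∎
  where
  open ≤-Reasoning
  w = u ++ bin v ++ [ false ]

-- Since |[v]| ≤ v/2 + 1, mutually head-bounded values are small.
small-solution : ∀ x y → x ≤ 4 + binLength y → y ≤ 4 + binLength x → x < 11
small-solution x y x≤ y≤ = s≤s (*-cancelˡ-≤ 3 (+-cancelˡ-≤ x (3 * x) (3 * 10) (begin
  4 * x             ≡⟨ *-assoc 2 2 x ⟩
  2 * (2 * x)       ≤⟨ *-monoʳ-≤ 2 (doubled x y x≤) ⟩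
  2 * (10 + y)      ≡⟨ *-distribˡ-+ 2 10 y ⟩
  20 + 2 * y        ≤⟨ +-monoʳ-≤ 20 (doubled y x y≤) ⟩
  30 + x            ≡⟨ +-comm 30 x ⟩
  x + 30            ∎)))
  where
  open ≤-Reasoning
  doubled : ∀ a b → a ≤ 4 + binLength b → 2 * a ≤ 10 + b
  doubled a b a≤ = begin
    2 * a                  ≤⟨ *-monoʳ-≤ 2 a≤ ⟩
    2 * (4 + binLength b)  ≡⟨ *-distribˡ-+ 2 4 (binLength b) ⟩
    8 + 2 * binLength b    ≤⟨ +-monoʳ-≤ 8 (binLength-half b) ⟩
    8 + (b + 2)            ≡⟨ cong (8 +_) (+-comm b 2) ⟩
    10 + b                 ∎

SolutionsBelow : ℕ → (ℕ → ℕ) → (ℕ → ℕ) → (ℕ → ℕ → Set) → Set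
SolutionsBelow N F G Good = ∀ {x} → x < N → ∀ {y} → y < N → x ≡ F y → y ≡ G x → Good x y

solutionsBelow? : ∀ N F G {Good : ℕ → ℕ → Set} → (∀ x y → Dec (Good x y)) → Dec (SolutionsBelow N F G Good)
solutionsBelow? N F G good? =
  allUpTo? (λ x → allUpTo? (λ y → (x ≟ F y) →-dec ((y ≟ G x) →-dec good? x y)) N) N

solve-circular : ∀ {F G Good} → HeadBound F → HeadBound G → SolutionsBelow 11 F G Good →
                 ∀ x y → x ≡ F y → y ≡ G x → Good x y
solve-circular {F} {G} boundF boundG solutions x y x≡ y≡ =
  solutions (small-solution x y x≤ y≤) (small-solution y x y≤ x≤) x≡ y≡
  where
  x≤ = subst (_≤ 4 + binLength y) (sym x≡) (boundF y)
  y≤ = subst (_≤ 4 + binLength x) (sym y≡) (boundG x)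

IsPairAt : ℕ → ℕ → ℕ → Set
IsPairAt n x y = x ≡ runsEven n × y ≡ runsOdd n

isPairAt? : ∀ n x y → Dec (IsPairAt n x y)
isPairAt? n x y = (x ≟ runsEven n) ×-dec (y ≟ runsOdd n)

-- The finite searches at the circular positions 0, 2 and 4; only at 2 is there a second
-- solution, the swapped pair.
search₀ : SolutionsBelow 11 (next [] 0) (next [] 0) (IsPairAt 0)
search₀ = from-yes (solutionsBelow? 11 (next [] 0) (next [] 0) (isPairAt? 0))

search₂ : SolutionsBelow 11 (next (1 ∷ 1 ∷ []) 2) (next (1 ∷ 1 ∷ []) 2) (λ x y → IsPairAt 2 x y ⊎ IsPairAt 2 y x)
search₂ = from-yes (solutionsBelow? 11 (next (1 ∷ 1 ∷ []) 2) (next (1 ∷ 1 ∷ []) 2) (λ x y → isPairAt? 2 x y ⊎-dec isPairAt? 2 y x))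

search₄ : SolutionsBelow 11 (next (1 ∷ 1 ∷ 4 ∷ 1 ∷ []) 4) (next (1 ∷ 1 ∷ 3 ∷ 3 ∷ []) 4) (IsPairAt 4)
search₄ = from-yes (solutionsBelow? 11 (next (1 ∷ 1 ∷ 4 ∷ 1 ∷ []) 4) (next (1 ∷ 1 ∷ 3 ∷ 3 ∷ []) 4) (isPairAt? 4))

cycle-start : ∀ {X Y} → TwoCycle X Y → AgreeBelow X Y 3 ⊎ AgreeBelow Y X 3
cycle-start {X} {Y} cycle = third (solve-circular bound bound search₂ (X 2) (Y 2) (proj₁ step₂) (proj₂ step₂))
  where
  bound : HeadBound (next (1 ∷ 1 ∷ []) 2)
  bound = headBound (true ∷ true ∷ []) (s≤s (s≤s z≤n))
  agree₀ : AgreeBelow X Y 0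
  agree₀ _ ()
  step₀ = circular-step cycle agree₀
  first : IsPairAt 0 (X 0) (Y 0)
  first = solve-circular (headBound [] z≤n) (headBound [] z≤n) search₀ (X 0) (Y 0) (proj₁ step₀) (proj₂ step₀)
  agree₁ = agree-snoc agree₀ (proj₁ first) (proj₂ first)
  X₁ = forced-step cycle agree₁ (s≤s (s≤s z≤n))
  agree₂ = agree-snoc agree₁ X₁ (follow-step cycle agree₁ X₁)
  step₂ = circular-step cycle agree₂
  third : IsPairAt 2 (X 2) (Y 2) ⊎ IsPairAt 2 (Y 2) (X 2) → AgreeBelow X Y 3 ⊎ AgreeBelow Y X 3
  third (inj₁ (X₂ , Y₂)) = inj₁ (agree-snoc agree₂ X₂ Y₂)
  third (inj₂ (Y₂ , X₂)) = inj₂ (agree-snoc (agree-swap₂ agree₂) Y₂ X₂)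

-- From position 3 on every value is forced: by causality, except by the search at 4.
cycle-extend : ∀ {X Y} → TwoCycle X Y → ∀ m → AgreeBelow X Y (3 + m) → AgreeBelow X Y (4 + m)
cycle-extend cycle zero agree = agree-snoc agree X₃ (follow-step cycle agree X₃)
  where X₃ = forced-step cycle agree (s≤s (s≤s (s≤s (s≤s z≤n))))
cycle-extend {X} {Y} cycle (suc zero) agree = agree-snoc agree (proj₁ fourth) (proj₂ fourth)
  where
  step₄ = circular-step cycle agree
  fourth : IsPairAt 4 (X 4) (Y 4)
  fourth = solve-circular (headBound (true ∷ true ∷ []) (s≤s (s≤s z≤n)))
                          (headBound (true ∷ true ∷ true ∷ []) (s≤s (s≤s (s≤s z≤n))))
                          search₄ (X 4) (Y 4) (proj₁ step₄) (proj₂ step₄)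
cycle-extend cycle (suc (suc d)) agree = agree-snoc agree Xn (follow-step cycle agree Xn)
  where Xn = forced-step cycle agree (runsOdd-ahead d)

cycle-agree : ∀ {X Y} → TwoCycle X Y → AgreeBelow X Y 3 → ∀ m → AgreeBelow X Y (3 + m)
cycle-agree cycle agree zero    = agree
cycle-agree cycle agree (suc m) = cycle-extend cycle m (cycle-agree cycle agree m)

twoCycle-unique : ∀ X Y → TwoCycle X Y →
                  (∀ k → X k ≡ runsEven k × Y k ≡ runsOdd k) ⊎ (∀ k → Y k ≡ runsEven k × X k ≡ runsOdd k)
twoCycle-unique X Y cycle@(X≡ , Y≡) = conclude (cycle-start cycle)
  where
  below : ∀ k → k < 3 + k
  below k = s≤s (m≤n+m k 2)
  conclude : AgreeBelow X Y 3 ⊎ AgreeBelow Y X 3 →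
             (∀ k → X k ≡ runsEven k × Y k ≡ runsOdd k) ⊎ (∀ k → Y k ≡ runsEven k × X k ≡ runsOdd k)
  conclude (inj₁ agree) = inj₁ (λ k → cycle-agree cycle agree k k (below k))
  conclude (inj₂ agree) = inj₂ (λ k → cycle-agree (Y≡ , X≡) agree k k (below k))

seqOf-of-runs : ∀ S p R → Runs S p → S 0 ≡ true → (∀ k → runLengths p k ≡ R k) → S ≗ˢ seqOf R
seqOf-of-runs S p R r S0 R≡ n = trans (seqOf-runLengths S p r S0 n) (seqOf-cong (runLengths p) R R≡ n)

theorem3 : Σ Seq λ Seven → Σ Seq λ Sodd →
             NotEventuallyConstant Seven × NotEventuallyConstant Sodd ×
             Knave Sodd Seven × Knave Seven Sodd ×
             (∀ A B → NotEventuallyConstant A → NotEventuallyConstant B →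
                Knave A B → Knave B A →
                ((A ≗ˢ Seven) × (B ≗ˢ Sodd)) ⊎ ((A ≗ˢ Sodd) × (B ≗ˢ Seven)))
theorem3 =
  seqOf runsEven , seqOf runsOdd ,
  seqOf-notEventuallyConstant runsEven runsEven-positive ,
  seqOf-notEventuallyConstant runsOdd runsOdd-positive ,
  knave-intro runsOdd runsEven runsOdd-positive runsEven-Ψ ,
  knave-intro runsEven runsOdd runsEven-positive runsOdd-Ψ ,
  unique
  where
  unique : ∀ A B → NotEventuallyConstant A → NotEventuallyConstant B → Knave A B → Knave B A →
           ((A ≗ˢ seqOf runsEven) × (B ≗ˢ seqOf runsOdd)) ⊎ ((A ≗ˢ seqOf runsOdd) × (B ≗ˢ seqOf runsEven))
  unique A B _ _ (pA , runsA , concatA) (pB , runsB , concatB) = conclude (twoCycle-unique RA RB cycle)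
    where
    RA = runLengths pA
    RB = runLengths pB
    A0 = knave-startsWith1 B A pB runsB concatB
    B0 = knave-startsWith1 A B pA runsA concatA
    cycle : TwoCycle RA RB
    cycle = knave-runLengths B A pB pA runsB concatB B0 runsA , knave-runLengths A B pA pB runsA concatA A0 runsB
    conclude : (∀ k → RA k ≡ runsEven k × RB k ≡ runsOdd k) ⊎ (∀ k → RB k ≡ runsEven k × RA k ≡ runsOdd k) →
               ((A ≗ˢ seqOf runsEven) × (B ≗ˢ seqOf runsOdd)) ⊎ ((A ≗ˢ seqOf runsOdd) × (B ≗ˢ seqOf runsEven))
    conclude (inj₁ same)    = inj₁ (seqOf-of-runs A pA _ runsA A0 (λ k → proj₁ (same k)) ,
                                    seqOf-of-runs B pB _ runsB B0 (λ k → proj₂ (same k)))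
    conclude (inj₂ swapped) = inj₂ (seqOf-of-runs A pA _ runsA A0 (λ k → proj₂ (swapped k)) ,
                                    seqOf-of-runs B pB _ runsB B0 (λ k → proj₁ (swapped k)))
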